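{- Let $k\ge2$, let $\mathcal{T}$ be a $k$-tree with maximum degree at least $2$, and let $\alpha_e\ne0$ for every $e\in E(\mathcal{T})$. If for some $u\in\mathcal{N}(\mathcal{T})$ and some set $P_{\mathcal{T}}(u)$ of $d_{\mathcal{T}}(u)-1$ pendent edges incident to $u$ the triple $(\mathcal{T},u,P_{\mathcal{T}}(u))$ is inadmissible, i.e. $\sum_{g\in P_{\mathcal{T}}(u)}\alpha_g=1$, then the $k$-star $\mathcal{F}$ induced by the edge set $P_{\mathcal{T}}(u)$ is generalized $\{\alpha_e\}_{e\in E(\mathcal{F})}$-normal.
   Context: A $k$-graph has a finite vertex set and an edge set of $k$-element vertex subsets; $d(v)$ is the number of edges containing $v$. A $k$-tree is a connected $k$-graph without cycles. A pendent edge is an edge containing exactly $k-1$ vertices of degree one. $\mathcal{N}(\mathcal{T})$ is the set of vertices $u$ with $d_{\mathcal{T}}(u)\ge2$ incident with at most one non-pendent edge. A $k$-star is a $k$-graph whose edges pairwise intersect exactly in one common vertex; the $k$-star induced by an edge set consists of those edges and their vertices. A weighted incidence matrix of a $k$-graph $\mathcal{H}$ is a complex matrix $B$ indexed by $V(\mathcal{H})\times E(\mathcal{H})$ with $B(v,e)\ne0$ iff $v\in e$. For nonzero complex $\{\alpha_e\}$, $\mathcal{H}$ is generalized $\{\alpha_e\}_{e\in E(\mathcal{H})}$-normal if there is a weighted incidence matrix $B$ with $\sum_{e\ni v}B(v,e)=1$ for every vertex $v$ and $\prod_{v\in e}B(v,e)=\alpha_e$ for every edge $e$. -}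

module Defs where

open import Level using (Level)
open import Data.Nat using (ℕ; zero; suc; _≟_; _≤_; _∸_)
open import Data.Fin using (Fin; zero; suc; inject₁; fromℕ)
open import Data.Fin.Subset using (Subset; _∈_; ∣_∣)
open import Data.Fin.Subset.Properties using (_∈?_)
open import Data.List using (List; length; filter; foldr; map)
open import Data.List.Base using ()
open import Data.Fin.Base using ()
open import Data.List using (allFin) renaming ()
open import Data.Product using (Σ; ∃; _×_; _,_)
open import Relation.Nullary using (¬_; Dec)
open import Relation.Nullary.Decidable using (_×-dec_; ¬?)
open import Relation.Binary.PropositionalEquality using (_≡_)
open import Function.Definitions using (Injective)
open import Algebra.Bundles using (CommutativeRing)

record KGraph (k : ℕ) : Set where
  field
    n m      : ℕ
    edge     : Fin m → Subset n
    edgeCard : ∀ e → ∣ edge e ∣ ≡ k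
    distinct : Injective _≡_ _≡_ edge
open KGraph public

module _ {k : ℕ} (H : KGraph k) where

  degree : Fin (n H) → ℕ
  degree v = length (filter (λ e → v ∈? edge H e) (allFin (m H)))

  data Walk : Fin (n H) → Fin (n H) → Set where
    here : ∀ {u} → Walk u u
    step : ∀ {u v w} (e : Fin (m H)) → u ∈ edge H e → v ∈ edge H e →
           Walk v w → Walk u w

  Connected : Set
  Connected = ∀ u w → Walk u w

  -- a (Berge) cycle of length t = suc (suc j) ≥ 2:
  -- distinct vertices v₁..v_t, distinct edges e₁..e_t, with v_i, v_{i+1} ∈ e_i
  -- (indices mod t)
  record Cycle (j : ℕ) : Set where
    field
      vs     : Fin (suc (suc j)) → Fin (n H)
      es     : Fin (suc (suc j)) → Fin (m H)
      vsInj  : Injective _≡_ _≡_ vs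
      esInj  : Injective _≡_ _≡_ es
      inner  : ∀ (i : Fin (suc j)) →
               (vs (inject₁ i) ∈ edge H (es (inject₁ i))) ×
               (vs (suc i) ∈ edge H (es (inject₁ i)))
      close  : (vs (fromℕ (suc j)) ∈ edge H (es (fromℕ (suc j)))) ×
               (vs zero ∈ edge H (es (fromℕ (suc j))))

  Acyclic : Set
  Acyclic = ∀ j → ¬ Cycle j

  IsKTree : Set
  IsKTree = Connected × Acyclic

  MaxDegreeAtLeast2 : Set
  MaxDegreeAtLeast2 = ∃ λ v → 2 ≤ degree v

  degOneCount : Fin (m H) → ℕ
  degOneCount e =
    length (filter (λ v → (v ∈? edge H e) ×-dec (degree v ≟ 1)) (allFin (n H)))

  Pendent : Fin (m H) → Set
  Pendent e = degOneCount e ≡ k ∸ 1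

  pendent? : ∀ e → Dec (Pendent e)
  pendent? e = degOneCount e ≟ k ∸ 1

  nonPendentIncident : Fin (n H) → ℕ
  nonPendentIncident u =
    length (filter (λ e → (u ∈? edge H e) ×-dec ¬? (pendent? e)) (allFin (m H)))

  InN : Fin (n H) → Set
  InN u = (2 ≤ degree u) × (nonPendentIncident u ≤ 1)

  InducedVertex : Subset (m H) → Fin (n H) → Set
  InducedVertex S v = ∃ λ e → (e ∈ S) × (v ∈ edge H e)

  module _ {c ℓ : Level} (R : CommutativeRing c ℓ) where
    open CommutativeRing R

    sumL : List Carrier → Carrier
    sumL = foldr _+_ 0#

    prodL : List Carrier → Carrier
    prodL = foldr _*_ 1#

    sumOver : Subset (m H) → (Fin (m H) → Carrier) → Carrier
    sumOver S α = sumL (map α (filter (_∈? S) (allFin (m H))))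

    -- The sub-k-graph F induced by the edge set S (vertex set: union of the
    -- edges in S, edge set: S) is generalized {α_e}_{e ∈ S}-normal: there is
    -- a weighted incidence matrix B of F (indexed by V(F) × S; entries
    -- outside V(F) × S are irrelevant) with row sums 1 and edge products α_e.
    GenNormalInduced : Subset (m H) → (Fin (m H) → Carrier) → Set (c Level.⊔ ℓ)
    GenNormalInduced S α =
      Σ (Fin (n H) → Fin (m H) → Carrier) λ B →
        (∀ v e → InducedVertex S v → e ∈ S →
            ((¬ (B v e ≈ 0#)) → v ∈ edge H e) × (v ∈ edge H e → ¬ (B v e ≈ 0#)))
        × (∀ v → InducedVertex S v →
            sumL (map (B v) (filter (λ e → (e ∈? S) ×-dec (v ∈? edge H e))
                                    (allFin (m H)))) ≈ 1#)
        × (∀ e → e ∈ S →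
            prodL (map (λ v → B v e) (filter (_∈? edge H e) (allFin (n H)))) ≈ α e)

{-# OPTIONS --safe #-}
-- Put weight α_e on the centre u in every edge e of the star and weight 1 on
-- its other vertices. Each edge product is then α_e, and the row sum at u is
-- Σ_{g ∈ P} α_g = 1 by inadmissibility. An edge g ∈ P is pendent, so k − 1 of
-- its k vertices have degree one; as d(u) ≥ 2, these are exactly the vertices
-- other than u. Such a vertex lies in no other edge, so its row sum is the
-- single entry 1.
module Submission where

open import Defs
open import Level using (Level)
open import Data.Nat using (ℕ; zero; suc; _≤_; _<_; _∸_; s≤s; z≤n)
  renaming (_≟_ to _≟ℕ_)
open import Data.Nat.Properties using (m≤n⇒m≤1+n; ≤-trans; 1+n≰n)
open import Data.Fin using (Fin; zero; suc) renaming (_≟_ to _≟ꟳ_)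
open import Data.Fin.Subset using (Subset; _∈_; ∣_∣; inside; outside)
open import Data.Fin.Subset.Properties using (_∈?_)
open import Data.Vec using ([]; _∷_)
open import Data.List using (List; []; _∷_; length; filter; map; foldr; tabulate; allFin)
open import Data.List.Properties using (filter-none)
open import Data.List.Relation.Unary.All as All using (All; []; _∷_)
open import Data.List.Relation.Unary.Any using (here; there)
open import Data.List.Relation.Unary.AllPairs using ([]; _∷_)
open import Data.List.Relation.Unary.Unique.Propositional using (Unique)
open import Data.List.Relation.Unary.Unique.Propositional.Properties using (allFin⁺)
open import Data.List.Membership.Propositional using () renaming (_∈_ to _∈ˡ_)
open import Data.List.Membership.Propositional.Properties using (∈-allFin)
open import Data.Product using (_×_; _,_; proj₁; proj₂)
open import Data.Empty using (⊥-elim)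
open import Relation.Nullary using (¬_; Dec; yes; no; does)
open import Relation.Nullary.Decidable using (_×-dec_)
open import Relation.Unary using (Pred; Decidable; _⊆_)
open import Relation.Unary.Properties using (∅?)
open import Relation.Binary.PropositionalEquality
  using (_≡_; _≢_; refl; sym; trans; cong; subst; subst₂)
open import Algebra.Bundles using (CommutativeRing)

module _ {a p q : Level} {A : Set a} {P : Pred A p} {Q : Pred A q}
         (P? : Decidable P) (Q? : Decidable Q) (Q⊆P : Q ⊆ P) where

  length-filter-mono : ∀ xs → length (filter Q? xs) ≤ length (filter P? xs)
  length-filter-mono [] = z≤n
  length-filter-mono (x ∷ xs) with Q? x | P? x
  ... | yes _  | yes _  = s≤s (length-filter-mono xs)
  ... | yes qx | no ¬px = ⊥-elim (¬px (Q⊆P qx))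
  ... | no _   | yes _  = m≤n⇒m≤1+n (length-filter-mono xs)
  ... | no _   | no _   = length-filter-mono xs

  length-filter-< : ∀ {y xs} → y ∈ˡ xs → P y → ¬ Q y →
                    length (filter Q? xs) < length (filter P? xs)
  length-filter-< {xs = x ∷ xs} (here refl) py ¬qy with Q? x | P? x
  ... | yes qy | _      = ⊥-elim (¬qy qy)
  ... | no _   | yes _  = s≤s (length-filter-mono xs)
  ... | no _   | no ¬py = ⊥-elim (¬py py)
  length-filter-< {xs = x ∷ xs} (there y∈xs) py ¬qy
    with length-filter-< y∈xs py ¬qy | Q? x | P? x
  ... | lt | yes _  | yes _  = s≤s lt
  ... | _  | yes qx | no ¬px = ⊥-elim (¬px (Q⊆P qx))
  ... | lt | no _   | yes _  = m≤n⇒m≤1+n lt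
  ... | lt | no _   | no _   = lt

  length-filter-2+ : ∀ {y z xs} → y ∈ˡ xs → z ∈ˡ xs → y ≢ z →
                     P y → P z → ¬ Q y → ¬ Q z →
                     suc (suc (length (filter Q? xs))) ≤ length (filter P? xs)
  length-filter-2+ (here refl) (here refl) y≢z _ _ _ _ = ⊥-elim (y≢z refl)
  length-filter-2+ {xs = x ∷ xs} (here refl) (there z∈xs) _ py pz ¬qy ¬qz
    with Q? x | P? x
  ... | yes qy | _      = ⊥-elim (¬qy qy)
  ... | no _   | yes _  = s≤s (length-filter-< z∈xs pz ¬qz)
  ... | no _   | no ¬py = ⊥-elim (¬py py)
  length-filter-2+ {xs = x ∷ xs} (there y∈xs) (here refl) _ py pz ¬qy ¬qz
    with Q? x | P? x
  ... | yes qz | _      = ⊥-elim (¬qz qz)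
  ... | no _   | yes _  = s≤s (length-filter-< y∈xs py ¬qy)
  ... | no _   | no ¬pz = ⊥-elim (¬pz pz)
  length-filter-2+ {xs = x ∷ xs} (there y∈xs) (there z∈xs) y≢z py pz ¬qy ¬qz
    with length-filter-2+ y∈xs z∈xs y≢z py pz ¬qy ¬qz | Q? x | P? x
  ... | le | yes _  | yes _  = s≤s le
  ... | _  | yes qx | no ¬px = ⊥-elim (¬px (Q⊆P qx))
  ... | le | no _   | yes _  = m≤n⇒m≤1+n le
  ... | le | no _   | no _   = le

length-filter-tabulate : ∀ {a q n} {A : Set a} {Q : Pred A q} (Q? : Decidable Q)
  (f : Fin n → A) (s : Subset n) → (∀ i → does (Q? (f i)) ≡ does (i ∈? s)) →
  length (filter Q? (tabulate f)) ≡ ∣ s ∣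
length-filter-tabulate Q? f [] agree = refl
length-filter-tabulate Q? f (inside ∷ s) agree with Q? (f zero) | agree zero
... | yes _ | _ = cong suc (length-filter-tabulate Q? (λ i → f (suc i)) s (λ i → agree (suc i)))
... | no _  | ()
length-filter-tabulate Q? f (outside ∷ s) agree with Q? (f zero) | agree zero
... | yes _ | ()
... | no _  | _ = length-filter-tabulate Q? (λ i → f (suc i)) s (λ i → agree (suc i))

module FilteredSums {c ℓ : Level} (R : CommutativeRing c ℓ) where
  open CommutativeRing R renaming (refl to ≈-refl) hiding (sym; trans)
  open import Relation.Binary.Reasoning.Setoid setoid

  1≉0 : ∀ {x} → ¬ x ≈ 0# → ¬ 1# ≈ 0#
  1≉0 {x} x≉0 1≈0 = x≉0 (begin
    x       ≈⟨ *-identityʳ x ⟨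
    x * 1#  ≈⟨ *-congˡ 1≈0 ⟩
    x * 0#  ≈⟨ zeroʳ x ⟩
    0#      ∎)

  module _ {a p q : Level} {A : Set a} {P : Pred A p} {Q : Pred A q}
           (P? : Decidable P) (Q? : Decidable Q) where

    sum-filter-cong : (f g : A → Carrier) → P ⊆ Q → Q ⊆ P →
                      (∀ {x} → P x → f x ≈ g x) → ∀ xs →
                      foldr _+_ 0# (map f (filter P? xs)) ≈ foldr _+_ 0# (map g (filter Q? xs))
    sum-filter-cong f g P⊆Q Q⊆P f≈g [] = ≈-refl
    sum-filter-cong f g P⊆Q Q⊆P f≈g (x ∷ xs) with P? x | Q? x
    ... | yes px | yes _  = +-cong (f≈g px) (sum-filter-cong f g P⊆Q Q⊆P f≈g xs)
    ... | yes px | no ¬qx = ⊥-elim (¬qx (P⊆Q px))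
    ... | no ¬px | yes qx = ⊥-elim (¬px (Q⊆P qx))
    ... | no _   | no _   = sum-filter-cong f g P⊆Q Q⊆P f≈g xs

  module _ {a q : Level} {A : Set a} {Q : Pred A q} (Q? : Decidable Q) where

    sum-filter-unique : (f : A → Carrier) {g : A} {xs : List A} → Unique xs →
                        g ∈ˡ xs → Q g → (∀ {x} → Q x → x ≡ g) →
                        foldr _+_ 0# (map f (filter Q? xs)) ≈ f g
    sum-filter-unique f {xs = x ∷ xs} (x∉xs ∷ _) g∈ qg only-g with Q? x
    ... | yes qx with only-g qx
    ... | refl rewrite filter-none Q? (All.map (λ x≢y qy → x≢y (sym (only-g qy))) x∉xs) =
      +-identityʳ (f x)
    sum-filter-unique f {xs = x ∷ xs} _ (here refl) qg only-g | no ¬qx = ⊥-elim (¬qx qg)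
    sum-filter-unique f {xs = x ∷ xs} (_ ∷ xs-unique) (there g∈) qg only-g | no _ =
      sum-filter-unique f xs-unique g∈ qg only-g

    prod-filter-ones : (h : A → Carrier) {w : A} {xs : List A} → All (_≢ w) xs →
                       (∀ {x} → Q x → x ≢ w → h x ≈ 1#) →
                       foldr _*_ 1# (map h (filter Q? xs)) ≈ 1#
    prod-filter-ones h [] ones = ≈-refl
    prod-filter-ones h {xs = x ∷ xs} (x≢w ∷ xs≢w) ones with Q? x
    ... | yes qx = begin
      h x * foldr _*_ 1# (map h (filter Q? xs))  ≈⟨ *-cong (ones qx x≢w) (prod-filter-ones h xs≢w ones) ⟩
      1# * 1#                                    ≈⟨ *-identityˡ 1# ⟩
      1#                                         ∎
    ... | no _ = prod-filter-ones h xs≢w ones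

    prod-filter-unique : (h : A → Carrier) {w : A} {xs : List A} → Unique xs →
                         w ∈ˡ xs → Q w → (∀ {x} → Q x → x ≢ w → h x ≈ 1#) →
                         foldr _*_ 1# (map h (filter Q? xs)) ≈ h w
    prod-filter-unique h {xs = x ∷ xs} (x∉xs ∷ _) (here refl) qw ones with Q? x
    ... | yes _ = begin
      h x * foldr _*_ 1# (map h (filter Q? xs))
        ≈⟨ *-congˡ (prod-filter-ones h (All.map (λ x≢y y≡x → x≢y (sym y≡x)) x∉xs) ones) ⟩
      h x * 1#  ≈⟨ *-identityʳ (h x) ⟩
      h x       ∎
    ... | no ¬qw = ⊥-elim (¬qw qw)
    prod-filter-unique h {w} {x ∷ xs} (x∉xs ∷ xs-unique) (there w∈) qw ones with Q? x
    ... | yes qx = begin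
      h x * foldr _*_ 1# (map h (filter Q? xs))
        ≈⟨ *-cong (ones qx (All.lookup x∉xs w∈)) (prod-filter-unique h xs-unique w∈ qw ones) ⟩
      1# * h w  ≈⟨ *-identityˡ (h w) ⟩
      h w       ∎
    ... | no _ = prod-filter-unique h xs-unique w∈ qw ones

module _ {k : ℕ} (T : KGraph k) where

  edge-size : ∀ e → length (filter (_∈? edge T e) (allFin (n T))) ≡ k
  edge-size e =
    trans (length-filter-tabulate (_∈? edge T e) (λ v → v) (edge T e) (λ _ → refl))
          (edgeCard T e)

  pendent⇒degree-one : ∀ {e u v} → Pendent T e → u ∈ edge T e → degree T u ≢ 1 →
                       v ∈ edge T e → v ≢ u → degree T v ≡ 1
  pendent⇒degree-one {e} {u} {v} pendent u∈e du≢1 v∈e v≢u with degree T v ≟ℕ 1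
  ... | yes dv≡1 = dv≡1
  ... | no dv≢1 = ⊥-elim (too-many k (subst₂ _≤_ (cong (λ d → suc (suc d)) pendent) (edge-size e)
                                                  two-non-leaves))
    where
    two-non-leaves : suc (suc (degOneCount T e)) ≤ length (filter (_∈? edge T e) (allFin (n T)))
    two-non-leaves =
      length-filter-2+ (_∈? edge T e) (λ w → (w ∈? edge T e) ×-dec (degree T w ≟ℕ 1)) proj₁
        (∈-allFin v) (∈-allFin u) v≢u v∈e u∈e (λ z → dv≢1 (proj₂ z)) (λ z → du≢1 (proj₂ z))

    too-many : ∀ j → ¬ suc (suc (j ∸ 1)) ≤ j
    too-many zero ()
    too-many (suc j) = 1+n≰n

  degree-one⇒unique-edge : ∀ {v e g} → degree T v ≡ 1 →
                           v ∈ edge T e → v ∈ edge T g → e ≡ g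
  degree-one⇒unique-edge {v} {e} {g} dv≡1 v∈e v∈g with e ≟ꟳ g
  ... | yes e≡g = e≡g
  ... | no e≢g = ⊥-elim (1+n≰n (subst (2 ≤_) dv≡1 (≤-trans (s≤s (s≤s z≤n))
        (length-filter-2+ (λ f → v ∈? edge T f) ∅? (λ ())
          (∈-allFin e) (∈-allFin g) e≢g v∈e v∈g (λ ()) (λ ())))))

module StarMatrix {c ℓ : Level} (R : CommutativeRing c ℓ) {k : ℕ} (T : KGraph k)
                  (α : Fin (m T) → CommutativeRing.Carrier R) (u : Fin (n T)) where
  open CommutativeRing R renaming (refl to ≈-refl; trans to ≈-trans) hiding (sym)
  open FilteredSums R

  weight : ∀ {a b} {X : Set a} {Y : Set b} → Dec X → Dec Y → Carrier → Carrier
  weight (yes _) (yes _) w = w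
  weight (yes _) (no _)  _ = 1#
  weight (no _)  _       _ = 0#

  module _ {a b} {X : Set a} {Y : Set b} {w : Carrier} where

    weight-centre : (x? : Dec X) (y? : Dec Y) → X → Y → weight x? y? w ≈ w
    weight-centre (yes _) (yes _) _ _ = ≈-refl
    weight-centre (yes _) (no ¬y) _ y = ⊥-elim (¬y y)
    weight-centre (no ¬x) _       x _ = ⊥-elim (¬x x)

    weight-leaf : (x? : Dec X) (y? : Dec Y) → X → ¬ Y → weight x? y? w ≈ 1#
    weight-leaf (yes _) (yes y) _ ¬y = ⊥-elim (¬y y)
    weight-leaf (yes _) (no _)  _ _  = ≈-refl
    weight-leaf (no ¬x) _       x _  = ⊥-elim (¬x x)

    weight-support : (x? : Dec X) (y? : Dec Y) → ¬ weight x? y? w ≈ 0# → X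
    weight-support (yes x) _ _   = x
    weight-support (no _)  _ ≉0 = ⊥-elim (≉0 ≈-refl)

    weight-≉0 : (x? : Dec X) (y? : Dec Y) → ¬ w ≈ 0# → X → ¬ weight x? y? w ≈ 0#
    weight-≉0 (yes _) (yes _) w≉0 _ = w≉0
    weight-≉0 (yes _) (no _)  w≉0 _ = 1≉0 w≉0
    weight-≉0 (no ¬x) _       _   x = ⊥-elim (¬x x)

  starMatrix : Fin (n T) → Fin (m T) → Carrier
  starMatrix v e = weight (v ∈? edge T e) (v ≟ꟳ u) (α e)

  module _ (P : Subset (m T)) where

    rowSum : Fin (n T) → Carrier
    rowSum v = sumL T R (map (starMatrix v)
                             (filter (λ e → (e ∈? P) ×-dec (v ∈? edge T e)) (allFin (m T))))

    centre-rowSum : (∀ {e} → e ∈ P → u ∈ edge T e) → sumOver T R P α ≈ 1# → rowSum u ≈ 1#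
    centre-rowSum u∈P Σα≈1 = ≈-trans
      (sum-filter-cong (λ e → (e ∈? P) ×-dec (u ∈? edge T e)) (_∈? P) (starMatrix u) α
        proj₁ (λ e∈P → e∈P , u∈P e∈P)
        (λ {e} z → weight-centre (u ∈? edge T e) (u ≟ꟳ u) (proj₂ z) refl)
        (allFin (m T)))
      Σα≈1

    leaf-rowSum : ∀ {v g} → degree T v ≡ 1 → g ∈ P → v ∈ edge T g → v ≢ u → rowSum v ≈ 1#
    leaf-rowSum {v} {g} dv≡1 g∈P v∈g v≢u = ≈-trans
      (sum-filter-unique (λ e → (e ∈? P) ×-dec (v ∈? edge T e)) (starMatrix v)
        (allFin⁺ (m T)) (∈-allFin g) (g∈P , v∈g)
        (λ z → degree-one⇒unique-edge T dv≡1 (proj₂ z) v∈g))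
      (weight-leaf (v ∈? edge T g) (v ≟ꟳ u) v∈g v≢u)

  edgeProduct : Fin (m T) → Carrier
  edgeProduct e = prodL T R (map (λ v → starMatrix v e) (filter (_∈? edge T e) (allFin (n T))))

  edgeProduct≈α : ∀ {e} → u ∈ edge T e → edgeProduct e ≈ α e
  edgeProduct≈α {e} u∈e = ≈-trans
    (prod-filter-unique (_∈? edge T e) (λ v → starMatrix v e) (allFin⁺ (n T)) (∈-allFin u) u∈e
      (λ {v} v∈e v≢u → weight-leaf (v ∈? edge T e) (v ≟ꟳ u) v∈e v≢u))
    (weight-centre (u ∈? edge T e) (u ≟ꟳ u) u∈e refl)

  starMatrix-genNormal : ∀ {P} → (∀ e → ¬ α e ≈ 0#) → degree T u ≢ 1 →
                         (∀ e → e ∈ P → Pendent T e × u ∈ edge T e) →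
                         sumOver T R P α ≈ 1# → GenNormalInduced T R P α
  starMatrix-genNormal {P} α≉0 du≢1 pendent-at-u Σα≈1 =
    starMatrix , incidence , rowSum≈1 , λ e e∈P → edgeProduct≈α (proj₂ (pendent-at-u e e∈P))
    where
    incidence : ∀ v e → InducedVertex T P v → e ∈ P →
                (¬ starMatrix v e ≈ 0# → v ∈ edge T e) × (v ∈ edge T e → ¬ starMatrix v e ≈ 0#)
    incidence v e _ _ = weight-support (v ∈? edge T e) (v ≟ꟳ u)
                      , weight-≉0 (v ∈? edge T e) (v ≟ꟳ u) (α≉0 e)

    rowSum≈1 : ∀ v → InducedVertex T P v → rowSum P v ≈ 1#
    rowSum≈1 v (g , g∈P , v∈g) = centre-or-leaf (v ≟ꟳ u)
      where
      centre-or-leaf : Dec (v ≡ u) → rowSum P v ≈ 1#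
      centre-or-leaf (yes v≡u) = subst (λ w → rowSum P w ≈ 1#) (sym v≡u)
        (centre-rowSum P (λ {e} e∈P → proj₂ (pendent-at-u e e∈P)) Σα≈1)
      centre-or-leaf (no v≢u) = leaf-rowSum P
        (pendent⇒degree-one T (proj₁ (pendent-at-u g g∈P)) (proj₂ (pendent-at-u g g∈P)) du≢1 v∈g v≢u)
        g∈P v∈g v≢u

corollary3p9 : ∀ {c ℓ : Level} (R : CommutativeRing c ℓ) (k : ℕ) → 2 ≤ k →
    (T : KGraph k) → IsKTree T → MaxDegreeAtLeast2 T →
    (α : Fin (m T) → CommutativeRing.Carrier R) →
    (∀ e → ¬ (CommutativeRing._≈_ R (α e) (CommutativeRing.0# R))) →
    (u : Fin (n T)) → InN T u →
    (P : Subset (m T)) → ∣ P ∣ ≡ degree T u ∸ 1 →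
    (∀ e → e ∈ P → Pendent T e × (u ∈ edge T e)) →
    CommutativeRing._≈_ R (sumOver T R P α) (CommutativeRing.1# R) →
    GenNormalInduced T R P α
corollary3p9 R _ _ T _ _ α α≉0 u (2≤du , _) P _ pendent-at-u Σα≈1 =
  StarMatrix.starMatrix-genNormal R T α u α≉0
    (λ du≡1 → 1+n≰n (subst (2 ≤_) du≡1 2≤du)) pendent-at-u Σα≈1
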